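{- If $x\neq\emptyset$ is a finite configuration of $[\![C]\!]$ with a covering chain $\emptyset\subset x_1\subset\cdots\subset x_n=x$ whose sequence of added events (read through their labels, with event $\tau_b^n$ read as $P_b^n$) is the word $\omega$, then there exists $C'$ such that $C \overset{\omega}{\twoheadrightarrow} C'$.
   Context: Quantum commands over $N$ qubits: $C ::= \mathtt{skip} \mid U(\vec n) \mid C;C \mid \mathtt{meas}\ n\ C_1\ C_2 \mid C\parallel C$, where $U(\vec n)$ applies unitary $U$ to qubits $\vec n$, $\mathtt{meas}\ n\ C_1\ C_2$ measures qubit $n$ and continues with $C_1$ after projection $P_0^n$ and with $C_2$ after $P_1^n$, and $C_1\parallel C_2$ requires disjoint qubit sets. Labels: $sk$, $U(\vec n)$, $P_0^n$, $P_1^n$. Small steps: $\mathtt{skip}\xrightarrow{sk}\checkmark$, $U(\vec n)\xrightarrow{U(\vec n)}\checkmark$, $\mathtt{meas}\ n\ C_1\ C_2\xrightarrow{P_0^n}C_1$ and $\xrightarrow{P_1^n}C_2$; sequential and parallel composition as usual (left component of $;$ moves, reaching $\checkmark$ leaves $C_2$; either side of $\parallel$ moves, a finished side is dropped). Multi-step: $C\overset{l}{\twoheadrightarrow}C'$ if $C\xrightarrow{l}C'$; $C\overset{l:\omega'}{\twoheadrightarrow}C'$ if $C\xrightarrow{l}C''\overset{\omega'}{\twoheadrightarrow}C'$. A unitary event structure is an event structure $(E,\le,\#)$ (partial order with finite down-closures, hereditary conflict; configurations are conflict-free down-closed sets) with a map $Q$ from events to unitary or projection operators such that concurrent events have commuting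 operators, minimal conflict is transitive, and the sum of $Q$ over each minimal-conflict class is unitary. Interpretation $[\![C]\!]$: $[\![\mathtt{skip}]\!]$ is one event $sk$ with $Q=Id$; $[\![U(\vec n)]\!]$ is one event with $Q=U(\vec n)$; $[\![C_1;C_2]\!]$ has events $E_1\uplus(E_2\times$ maximal configurations of $[\![C_1]\!])$, with $e_1\le(e_2,x)$ for $e_1\in x$ and $Q$ inherited; $[\![\mathtt{meas}\ n\ C_1\ C_2]\!]$ has new events $\tau_0^n,\tau_1^n$ (with $Q=P_0^n,P_1^n$) in conflict, $\tau_0^n$ below all events of $[\![C_1]\!]$ and $\tau_1^n$ below all of $[\![C_2]\!]$, everything on the $\tau_0^n$ side in conflict with everything on the $\tau_1^n$ side; $[\![C_1\parallel C_2]\!]$ is the disjoint union. A covering chain of $x$ is a chain $\emptyset\subset x_1\subset\cdots\subset x_n=x$ of configurations each adding one event. -}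

module Defs where

open import Data.Bool using (Bool; true; false; _∧_; _∨_; not; T)
open import Data.Nat using (ℕ; zero; suc; _+_; _*_)
open import Data.Fin using (Fin; zero; suc; splitAt; remQuot)
import Data.Fin as F
open import Data.Fin.Subset using (Subset; _∈_; _∉_; ⁅_⁆; _∪_; ⊥)
open import Data.Vec using (Vec; []; _∷_; lookup)
open import Data.List using (List; []; _∷_; _++_; map; length; filterᵇ; allFin; _∷ʳ_)
open import Data.Bool.ListAction using (all; any)
import Data.List as L
open import Data.List.Membership.Propositional using () renaming (_∈_ to _∈ₗ_)
open import Data.Sum using (_⊎_; inj₁; inj₂)
open import Data.Product using (_×_; _,_)
open import Relation.Nullary using (¬_)
open import Relation.Nullary.Decidable using (⌊_⌋)

-- Quantum commands over N qubits; unitaries are drawn from an arbitrary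
-- set G of unitary names, U(n⃗) is  gate U n⃗.

data Cmd (G : Set) (N : ℕ) : Set where
  skip : Cmd G N
  gate : G → List (Fin N) → Cmd G N
  _⨾_  : Cmd G N → Cmd G N → Cmd G N
  meas : Fin N → Cmd G N → Cmd G N → Cmd G N
  _∥_  : Cmd G N → Cmd G N → Cmd G N

infixr 5 _⨾_
infixr 4 _∥_

module _ {G : Set} {N : ℕ} where

  qubits : Cmd G N → List (Fin N)
  qubits skip         = []
  qubits (gate u qs)  = qs
  qubits (C₁ ⨾ C₂)    = qubits C₁ ++ qubits C₂
  qubits (meas n C₁ C₂) = n ∷ (qubits C₁ ++ qubits C₂)
  qubits (C₁ ∥ C₂)    = qubits C₁ ++ qubits C₂

  data WF : Cmd G N → Set where
    wf-skip : WF skip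
    wf-gate : ∀ u qs → WF (gate u qs)
    wf-seq  : ∀ {C₁ C₂} → WF C₁ → WF C₂ → WF (C₁ ⨾ C₂)
    wf-meas : ∀ {n C₁ C₂} → WF C₁ → WF C₂ → WF (meas n C₁ C₂)
    wf-par  : ∀ {C₁ C₂} → WF C₁ → WF C₂ →
              (∀ q → q ∈ₗ qubits C₁ → ¬ (q ∈ₗ qubits C₂)) → WF (C₁ ∥ C₂)

data Label (G : Set) (N : ℕ) : Set where
  sk : Label G N
  U  : G → List (Fin N) → Label G N
  P  : Fin 2 → Fin N → Label G N

-- result of a step: either ✓ (terminated) or a command
data Res (G : Set) (N : ℕ) : Set where
  ✓   : Res G N
  ⟨_⟩ : Cmd G N → Res G N

module _ {G : Set} {N : ℕ} where

  infix 3 _—[_]→_ _=[_]↠_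

  data _—[_]→_ : Cmd G N → Label G N → Res G N → Set where
    skip→  : skip —[ sk ]→ ✓
    gate→  : ∀ {u qs} → gate u qs —[ U u qs ]→ ✓
    meas₀  : ∀ {n C₁ C₂} → meas n C₁ C₂ —[ P zero n ]→ ⟨ C₁ ⟩
    meas₁  : ∀ {n C₁ C₂} → meas n C₁ C₂ —[ P (suc zero) n ]→ ⟨ C₂ ⟩
    seq✓   : ∀ {C₁ C₂ l} → C₁ —[ l ]→ ✓ → (C₁ ⨾ C₂) —[ l ]→ ⟨ C₂ ⟩
    seq→   : ∀ {C₁ C₁' C₂ l} → C₁ —[ l ]→ ⟨ C₁' ⟩ → (C₁ ⨾ C₂) —[ l ]→ ⟨ C₁' ⨾ C₂ ⟩
    parL✓  : ∀ {C₁ C₂ l} → C₁ —[ l ]→ ✓ → (C₁ ∥ C₂) —[ l ]→ ⟨ C₂ ⟩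
    parL→  : ∀ {C₁ C₁' C₂ l} → C₁ —[ l ]→ ⟨ C₁' ⟩ → (C₁ ∥ C₂) —[ l ]→ ⟨ C₁' ∥ C₂ ⟩
    parR✓  : ∀ {C₁ C₂ l} → C₂ —[ l ]→ ✓ → (C₁ ∥ C₂) —[ l ]→ ⟨ C₁ ⟩
    parR→  : ∀ {C₁ C₂ C₂' l} → C₂ —[ l ]→ ⟨ C₂' ⟩ → (C₁ ∥ C₂) —[ l ]→ ⟨ C₁ ∥ C₂' ⟩

  data _=[_]↠_ : Cmd G N → List (Label G N) → Res G N → Set where
    one  : ∀ {C l R} → C —[ l ]→ R → C =[ l ∷ [] ]↠ R
    more : ∀ {C C'' l ω R} → C —[ l ]→ ⟨ C'' ⟩ → C'' =[ ω ]↠ R → C =[ l ∷ ω ]↠ R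

-- Finite labelled event structures, events = Fin size, with decidable
-- (Bool-valued) order and conflict relations.  (The operator map Q is
-- not needed for the statement.)

record EvStr (G : Set) (N : ℕ) : Set where
  field
    size  : ℕ
    _≤ᵉ_  : Fin size → Fin size → Bool
    _#ᵉ_  : Fin size → Fin size → Bool
    label : Fin size → Label G N

module _ {G : Set} {N : ℕ} (E : EvStr G N) where
  open EvStr E

  record IsConfig (x : Subset size) : Set where
    field
      downClosed   : ∀ e e' → T (e' ≤ᵉ e) → e ∈ x → e' ∈ x
      conflictFree : ∀ e e' → e ∈ x → e' ∈ x → ¬ T (e #ᵉ e')

  -- covering chains  ∅ ⊂ x₁ ⊂ ⋯ ⊂ xₙ = x, each step adding one event;
  -- the list records the added events in order.
  data CoveringChain : Subset size → List (Fin size) → Set where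
    start  : CoveringChain ⊥ []
    extend : ∀ {x es e} → CoveringChain x es → e ∉ x →
             IsConfig (x ∪ ⁅ e ⁆) → CoveringChain (x ∪ ⁅ e ⁆) (es ∷ʳ e)

  private
    evs : List (Fin size)
    evs = allFin size

  isConfigᵇ : Subset size → Bool
  isConfigᵇ x = all (λ e → all (λ e' →
      (not ((e' ≤ᵉ e) ∧ lookup x e) ∨ lookup x e')
      ∧ not (lookup x e ∧ lookup x e' ∧ (e #ᵉ e'))) evs) evs

  allSubsets : ∀ n → List (Subset n)
  allSubsets zero    = [] ∷ []
  allSubsets (suc n) = map (false ∷_) (allSubsets n) ++ map (true ∷_) (allSubsets n)

  ⊆ᵇ : ∀ {n} → Subset n → Subset n → Bool
  ⊆ᵇ []      []      = true
  ⊆ᵇ (a ∷ x) (b ∷ y) = (not a ∨ b) ∧ ⊆ᵇ x y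

  ⊂ᵇ : ∀ {n} → Subset n → Subset n → Bool
  ⊂ᵇ x y = ⊆ᵇ x y ∧ not (⊆ᵇ y x)

  isMaxConfigᵇ : Subset size → Bool
  isMaxConfigᵇ x = isConfigᵇ x
    ∧ not (any (λ y → isConfigᵇ y ∧ ⊂ᵇ x y) (allSubsets size))

  maxConfigs : List (Subset size)
  maxConfigs = filterᵇ isMaxConfigᵇ (allSubsets size)

module _ {G : Set} {N : ℕ} where
  open EvStr

  single : Label G N → EvStr G N
  single l = record { size = 1 ; _≤ᵉ_ = λ _ _ → true ; _#ᵉ_ = λ _ _ → false
                    ; label = λ _ → l }

  parES : EvStr G N → EvStr G N → EvStr G N
  parES E₁ E₂ = record { size = size E₁ + size E₂ ; _≤ᵉ_ = le ; _#ᵉ_ = cf ; label = lb }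
    where
    le : _ → _ → Bool
    le i j with splitAt (size E₁) i | splitAt (size E₁) j
    ... | inj₁ a | inj₁ b = _≤ᵉ_ E₁ a b
    ... | inj₂ a | inj₂ b = _≤ᵉ_ E₂ a b
    ... | _      | _      = false
    cf : _ → _ → Bool
    cf i j with splitAt (size E₁) i | splitAt (size E₁) j
    ... | inj₁ a | inj₁ b = _#ᵉ_ E₁ a b
    ... | inj₂ a | inj₂ b = _#ᵉ_ E₂ a b
    ... | _      | _      = false
    lb : _ → Label G N
    lb i with splitAt (size E₁) i
    ... | inj₁ a = label E₁ a
    ... | inj₂ b = label E₂ b

  data MeasEv (n₁ n₂ : ℕ) : Set where
    τ₀ τ₁ : MeasEv n₁ n₂
    lft   : Fin n₁ → MeasEv n₁ n₂
    rgt   : Fin n₂ → MeasEv n₁ n₂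

  measDecode : ∀ {n₁ n₂} → Fin (2 + (n₁ + n₂)) → MeasEv n₁ n₂
  measDecode zero = τ₀
  measDecode (suc zero) = τ₁
  measDecode {n₁} (suc (suc i)) with splitAt n₁ i
  ... | inj₁ a = lft a
  ... | inj₂ b = rgt b

  measSide : ∀ {n₁ n₂} → MeasEv n₁ n₂ → Fin 2
  measSide τ₀      = zero
  measSide τ₁      = suc zero
  measSide (lft _) = zero
  measSide (rgt _) = suc zero

  measES : Fin N → EvStr G N → EvStr G N → EvStr G N
  measES n E₁ E₂ = record { size = 2 + (size E₁ + size E₂)
                          ; _≤ᵉ_ = λ i j → le (measDecode i) (measDecode j)
                          ; _#ᵉ_ = λ i j → cf (measDecode i) (measDecode j)
                          ; label = λ i → lb (measDecode i) }
    where
    le : MeasEv _ _ → MeasEv _ _ → Bool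
    le τ₀ τ₀ = true
    le τ₀ (lft _) = true
    le τ₁ τ₁ = true
    le τ₁ (rgt _) = true
    le (lft a) (lft b) = _≤ᵉ_ E₁ a b
    le (rgt a) (rgt b) = _≤ᵉ_ E₂ a b
    le _ _ = false
    cf : MeasEv _ _ → MeasEv _ _ → Bool
    cf (lft a) (lft b) = _#ᵉ_ E₁ a b
    cf (rgt a) (rgt b) = _#ᵉ_ E₂ a b
    cf u v = not ⌊ measSide u F.≟ measSide v ⌋
    lb : MeasEv _ _ → Label G N
    lb τ₀ = P zero n
    lb τ₁ = P (suc zero) n
    lb (lft a) = label E₁ a
    lb (rgt b) = label E₂ b

  -- sequential composition: E₁ ⊎ (E₂ × maximal configurations of E₁)
  data SeqEv (n₁ n₂ : ℕ) (M : List (Subset n₁)) : Set where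
    fst : Fin n₁ → SeqEv n₁ n₂ M
    snd : Fin n₂ → Fin (length M) → SeqEv n₁ n₂ M

  seqDecode : ∀ {n₁ n₂} (M : List (Subset n₁)) → Fin (n₁ + n₂ * length M) → SeqEv n₁ n₂ M
  seqDecode {n₁} M i with splitAt n₁ i
  ... | inj₁ a = fst a
  ... | inj₂ j with remQuot (length M) j
  ...   | (e , k) = snd e k

  seqES : EvStr G N → EvStr G N → EvStr G N
  seqES E₁ E₂ = record { size = size E₁ + size E₂ * length M
                       ; _≤ᵉ_ = λ i j → le (seqDecode M i) (seqDecode M j)
                       ; _#ᵉ_ = λ i j → cf (seqDecode M i) (seqDecode M j)
                       ; label = λ i → lb (seqDecode M i) }
    where
    M = maxConfigs E₁
    le : SeqEv _ (size E₂) M → SeqEv _ (size E₂) M → Bool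
    le (fst a) (fst b) = _≤ᵉ_ E₁ a b
    le (fst a) (snd e k) = lookup (L.lookup M k) a
    le (snd e k) (fst b) = false
    le (snd e k) (snd e' k') = ⌊ k F.≟ k' ⌋ ∧ _≤ᵉ_ E₂ e e'
    cf : SeqEv _ (size E₂) M → SeqEv _ (size E₂) M → Bool
    cf (fst a) (fst b) = _#ᵉ_ E₁ a b
    cf (fst a) (snd e k) = not (lookup (L.lookup M k) a)    -- hereditary conflict
    cf (snd e k) (fst b) = not (lookup (L.lookup M k) b)
    cf (snd e k) (snd e' k') = not ⌊ k F.≟ k' ⌋ ∨ _#ᵉ_ E₂ e e'
    lb : SeqEv _ (size E₂) M → Label G N
    lb (fst a) = label E₁ a
    lb (snd e k) = label E₂ e

  ⟦_⟧ : Cmd G N → EvStr G N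
  ⟦ skip ⟧         = single sk
  ⟦ gate u qs ⟧    = single (U u qs)
  ⟦ C₁ ⨾ C₂ ⟧      = seqES ⟦ C₁ ⟧ ⟦ C₂ ⟧
  ⟦ meas n C₁ C₂ ⟧ = measES n ⟦ C₁ ⟧ ⟦ C₂ ⟧
  ⟦ C₁ ∥ C₂ ⟧      = parES ⟦ C₁ ⟧ ⟦ C₂ ⟧

module Submission where

-- Run C alongside the chain.  The invariant Residual C f R, defined by recursion on C through the
-- decomposition of ⟦ C ⟧ into its components, says that performing the events of the configuration f
-- turns C into R.  Adding an event that keeps f a configuration is matched by a small step of R with
-- the label of that event.  The delicate case is sequential composition: an event in the copy of ⟦ C₂ ⟧
-- attached to a maximal configuration x of ⟦ C₁ ⟧ forces the ⟦ C₁ ⟧-part of f to be x, so C₁ must have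
-- terminated, since the configuration of a command that is still running can always be extended.

open import Defs
open import Data.Bool using (Bool; true; false; _∧_; _∨_; not; T)
open import Data.Bool.Properties using (∨-zeroʳ; ∨-identityʳ; T-∧; T-≡; ¬-not)
open import Data.Bool.ListAction using (all; any)
open import Data.Empty using (⊥-elim)
open import Data.Fin using (Fin; zero; suc; _≟_; _↑ˡ_; _↑ʳ_; splitAt; join; combine)
open import Data.Fin.Properties
  using (any?; splitAt-↑ˡ; splitAt-↑ʳ; splitAt⁻¹-↑ˡ; splitAt⁻¹-↑ʳ; splitAt-join; join-splitAt;
         remQuot-combine; combine-remQuot)
open import Data.Fin.Subset using (Subset; Nonempty; _∉_; _∪_; ⁅_⁆)
open import Data.Fin.Subset.Properties using (∉⊥; x∈⁅x⁆; x≢y⇒x∉⁅y⁆)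
open import Data.List using (List; []; _∷_; map; length; allFin; _∷ʳ_)
import Data.List as List
open import Data.List.Membership.Propositional using () renaming (_∈_ to _∈ₗ_)
open import Data.List.Membership.Propositional.Properties
  using (∈-allFin; ∈-filter⁺; ∈-filter⁻; ∈-lookup; ∈-map⁺; ∈-++⁺ˡ; ∈-++⁺ʳ)
open import Data.List.Properties using (map-++)
import Data.List.Relation.Unary.All as All
open import Data.List.Relation.Unary.All.Properties using (all⁺; all⁻)
import Data.List.Relation.Unary.Any as Any
open import Data.List.Relation.Unary.Any.Properties using (any⁺; any⁻; lookup-index)
open import Data.Nat using (ℕ; suc; _*_)
open import Data.Product using (_×_; _,_; ∃; ∃₂; proj₁; proj₂)
open import Data.Sum using (_⊎_; inj₁; inj₂)
import Data.Sum as Sum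
open import Data.Unit using (tt)
open import Data.Vec using ([]; _∷_; lookup; tabulate)
open import Data.Vec.Properties using ([]=⇒lookup; lookup⇒[]=; lookup∘tabulate; lookup-zipWith; lookup-replicate)
open import Function using (_∘_; const; Injective)
open import Function.Bundles using (Equivalence)
open import Relation.Binary.PropositionalEquality
open import Relation.Nullary using (¬_; Dec; yes; no; contradiction)
open import Relation.Nullary.Decidable using (⌊_⌋; T?)

open EvStr using (size; _≤ᵉ_; _#ᵉ_; label)

contradictionᵇ : ∀ {A : Set} {b} → b ≡ true → b ≡ false → A
contradictionᵇ refl ()

⌊⌋-yes : ∀ {A : Set} (a? : Dec A) → A → ⌊ a? ⌋ ≡ true
⌊⌋-yes (yes _) _ = refl
⌊⌋-yes (no ¬a) a = contradiction a ¬a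

⌊⌋-no : ∀ {A : Set} (a? : Dec A) → ¬ A → ⌊ a? ⌋ ≡ false
⌊⌋-no (yes a) ¬a = contradiction a ¬a
⌊⌋-no (no _)  _  = refl

T-not⁺ : ∀ {b} → ¬ T b → T (not b)
T-not⁺ {true}  ¬b = ¬b tt
T-not⁺ {false} _  = tt

T-not-true : ∀ {b} → b ≡ true → ¬ T (not b)
T-not-true refl ()

T-not⁻ : ∀ {b} → T (not b) → ¬ T b
T-not⁻ {false} _ ()

lookup-∉ : ∀ {n} {x : Subset n} {i} → i ∉ x → lookup x i ≡ false
lookup-∉ {x = x} {i} i∉x with lookup x i in eq
... | true  = contradiction (lookup⇒[]= i x eq) i∉x
... | false = refl

-- Sets of events are Boolean predicates rather than subsets, so that they can be precomposed with the
-- encodings of the events of composite event structures; f +ₑ e is f ∪ {e}.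

infixl 6 _+ₑ_

_+ₑ_ : ∀ {n} → (Fin n → Bool) → Fin n → Fin n → Bool
(f +ₑ e) i = f i ∨ ⌊ i ≟ e ⌋

module _ {n} (f : Fin n → Bool) (e : Fin n) where

  +ₑ-new : (f +ₑ e) e ≡ true
  +ₑ-new rewrite ⌊⌋-yes (e ≟ e) refl = ∨-zeroʳ (f e)

  +ₑ-old : ∀ {i} → f i ≡ true → (f +ₑ e) i ≡ true
  +ₑ-old p rewrite p = refl

  +ₑ-other : ∀ {i} → i ≢ e → (f +ₑ e) i ≡ f i
  +ₑ-other {i} i≢e rewrite ⌊⌋-no (i ≟ e) i≢e = ∨-identityʳ (f i)

+ₑ-∘ : ∀ {m n} (h : Fin m → Fin n) → Injective _≡_ _≡_ h →
       ∀ f e → (f +ₑ h e) ∘ h ≗ (f ∘ h) +ₑ e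
+ₑ-∘ h h-inj f e i with i ≟ e
... | yes refl = cong (f (h i) ∨_) (⌊⌋-yes (h i ≟ h i) refl)
... | no i≢e   = cong (f (h i) ∨_) (⌊⌋-no (h i ≟ h e) (i≢e ∘ h-inj))

lookup-∪⁅⁆ : ∀ {n} (x : Subset n) e → lookup (x ∪ ⁅ e ⁆) ≗ lookup x +ₑ e
lookup-∪⁅⁆ x e i = trans (lookup-zipWith _∨_ i x ⁅ e ⁆) (cong (lookup x i ∨_) (lookup-⁅⁆ i))
  where
  lookup-⁅⁆ : ∀ i → lookup ⁅ e ⁆ i ≡ ⌊ i ≟ e ⌋
  lookup-⁅⁆ i with i ≟ e
  ... | yes refl = []=⇒lookup (x∈⁅x⁆ e)
  ... | no i≢e   = lookup-∉ (x≢y⇒x∉⁅y⁆ i≢e)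

module _ {G : Set} {N : ℕ} (E : EvStr G N) where

  record IsCfg (f : Fin (size E) → Bool) : Set where
    field
      down-closed   : ∀ e e' → T (_≤ᵉ_ E e' e) → f e ≡ true → f e' ≡ true
      conflict-free : ∀ e e' → f e ≡ true → f e' ≡ true → ¬ T (_#ᵉ_ E e e')

  Saturated : (Fin (size E) → Bool) → Set
  Saturated f = ∀ e → f e ≡ true ⊎ ∃ λ e' → f e' ≡ true × T (_#ᵉ_ E e e')

module _ {G : Set} {N : ℕ} {E : EvStr G N} where

  IsCfg-resp : ∀ {f g} → f ≗ g → IsCfg E f → IsCfg E g
  IsCfg-resp f≗g c = record
    { down-closed   = λ e e' le ge → trans (sym (f≗g e')) (down-closed e e' le (trans (f≗g e) ge))
    ; conflict-free = λ e e' ge ge' → conflict-free e e' (trans (f≗g e) ge) (trans (f≗g e') ge') }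
    where open IsCfg c

  IsCfg-∅ : IsCfg E (const false)
  IsCfg-∅ = record { down-closed = λ _ _ _ () ; conflict-free = λ _ _ () }

  IsConfig⇒IsCfg : ∀ {x} → IsConfig E x → IsCfg E (lookup x)
  IsConfig⇒IsCfg {x} c = record
    { down-closed   = λ e e' le xe → []=⇒lookup (downClosed e e' le (lookup⇒[]= e x xe))
    ; conflict-free = λ e e' xe xe' → conflictFree e e' (lookup⇒[]= e x xe) (lookup⇒[]= e' x xe') }
    where open IsConfig c

  Saturated⇒unextendable : ∀ {f e} → Saturated E f → f e ≡ false → ¬ IsCfg E (f +ₑ e)
  Saturated⇒unextendable {f} {e} sat fe c with sat e
  ... | inj₁ fe-true          = contradictionᵇ fe-true fe
  ... | inj₂ (e' , fe' , e#e') =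
    IsCfg.conflict-free c e e' (+ₑ-new f e) (+ₑ-old f e fe') e#e'

  Saturated-witness : ∀ {f} → Saturated E f → Fin (size E) → ∃ λ e → f e ≡ true
  Saturated-witness sat e with sat e
  ... | inj₁ fe              = e , fe
  ... | inj₂ (e' , fe' , _) = e' , fe'

private
  pairᵇ : Bool → Bool → Bool → Bool → Bool
  pairᵇ le xe xe' cf = (not (le ∧ xe) ∨ xe') ∧ not (xe ∧ xe' ∧ cf)

  pairᵇ-down : ∀ le xe xe' cf → T (pairᵇ le xe xe' cf) → T le → xe ≡ true → xe' ≡ true
  pairᵇ-down true true true _ _ _ _ = refl

  pairᵇ-conflict : ∀ le xe xe' cf → T (pairᵇ le xe xe' cf) → xe ≡ true → xe' ≡ true → ¬ T cf
  pairᵇ-conflict true  true true true () _ _ _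
  pairᵇ-conflict false true true true () _ _ _

  pairᵇ-intro : ∀ le xe xe' cf → (T le → xe ≡ true → xe' ≡ true) →
                (xe ≡ true → xe' ≡ true → ¬ T cf) → T (pairᵇ le xe xe' cf)
  pairᵇ-intro true  false _     _     _ _ = tt
  pairᵇ-intro false false _     _     _ _ = tt
  pairᵇ-intro false true  false _     _ _ = tt
  pairᵇ-intro true  true  false _     d _ with () ← d tt refl
  pairᵇ-intro true  true  true  false _ _ = tt
  pairᵇ-intro false true  true  false _ _ = tt
  pairᵇ-intro _     true  true  true  _ c = ⊥-elim (c refl refl tt)

module _ {G : Set} {N : ℕ} (E : EvStr G N) where

  private
    pairOk : Subset (size E) → Fin (size E) → Fin (size E) → Bool
    pairOk x e e' = pairᵇ (_≤ᵉ_ E e' e) (lookup x e) (lookup x e') (_#ᵉ_ E e e')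

    rowOk : Subset (size E) → Fin (size E) → Bool
    rowOk x e = all (pairOk x e) (allFin (size E))

  isConfigᵇ-sound : ∀ x → T (isConfigᵇ E x) → IsCfg E (lookup x)
  isConfigᵇ-sound x h = record
    { down-closed   = λ e e' → pairᵇ-down (_≤ᵉ_ E e' e) (lookup x e) (lookup x e') (_#ᵉ_ E e e') (ok e e')
    ; conflict-free = λ e e' → pairᵇ-conflict (_≤ᵉ_ E e' e) (lookup x e) (lookup x e') (_#ᵉ_ E e e') (ok e e') }
    where
    ok : ∀ e e' → T (pairOk x e e')
    ok e e' = All.lookup (all⁺ (pairOk x e) _ (All.lookup (all⁺ (rowOk x) _ h) (∈-allFin e))) (∈-allFin e')

  isConfigᵇ-complete : ∀ x → IsCfg E (lookup x) → T (isConfigᵇ E x)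
  isConfigᵇ-complete x c =
    all⁻ (rowOk x) {allFin (size E)} (All.tabulate λ {e} _ →
      all⁻ (pairOk x e) {allFin (size E)} (All.tabulate λ {e'} _ →
        pairᵇ-intro (_≤ᵉ_ E e' e) (lookup x e) (lookup x e') (_#ᵉ_ E e e')
          (IsCfg.down-closed c e e') (IsCfg.conflict-free c e e')))

  ⊆ᵇ-sound : ∀ {n} (x y : Subset n) → T (⊆ᵇ E x y) → ∀ i → lookup x i ≡ true → lookup y i ≡ true
  ⊆ᵇ-sound (true  ∷ x) (true ∷ y) _ zero    _ = refl
  ⊆ᵇ-sound (true  ∷ x) (true ∷ y) h (suc i) p = ⊆ᵇ-sound x y h i p
  ⊆ᵇ-sound (false ∷ x) (_    ∷ y) h (suc i) p = ⊆ᵇ-sound x y h i p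

  ⊆ᵇ-complete : ∀ {n} (x y : Subset n) → (∀ i → lookup x i ≡ true → lookup y i ≡ true) → T (⊆ᵇ E x y)
  ⊆ᵇ-complete []          []      _ = tt
  ⊆ᵇ-complete (false ∷ x) (_ ∷ y) h = ⊆ᵇ-complete x y (h ∘ suc)
  ⊆ᵇ-complete (true  ∷ x) (_ ∷ y) h rewrite h zero refl = ⊆ᵇ-complete x y (h ∘ suc)

  ∈-allSubsets : ∀ {n} (y : Subset n) → y ∈ₗ allSubsets E n
  ∈-allSubsets []                  = Any.here refl
  ∈-allSubsets {suc n} (false ∷ y) = ∈-++⁺ˡ (∈-map⁺ (false ∷_) (∈-allSubsets y))
  ∈-allSubsets {suc n} (true  ∷ y) = ∈-++⁺ʳ _ (∈-map⁺ (true ∷_) (∈-allSubsets y))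

  maxConfig : Fin (length (maxConfigs E)) → Subset (size E)
  maxConfig = List.lookup (maxConfigs E)

  maxConfig-isMax : ∀ k → T (isMaxConfigᵇ E (maxConfig k))
  maxConfig-isMax k = proj₂ (∈-filter⁻ (T? ∘ isMaxConfigᵇ E) {xs = allSubsets E (size E)} (∈-lookup k))

  maxConfig-IsCfg : ∀ k → IsCfg E (lookup (maxConfig k))
  maxConfig-IsCfg k = isConfigᵇ-sound (maxConfig k) (proj₁ (Equivalence.to T-∧ (maxConfig-isMax k)))

  maxConfig-unextendable : ∀ k {g a} → lookup (maxConfig k) ≗ g → g a ≡ false → ¬ IsCfg E (g +ₑ a)
  maxConfig-unextendable k {g} {a} x≗g ga c =
    T-not⁻ (proj₂ (Equivalence.to T-∧ (maxConfig-isMax k)))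
           (any⁺ _ (Any.map (λ { refl → x⊂y }) (∈-allSubsets y)))
    where
    x = maxConfig k
    y = tabulate (g +ₑ a)
    y≗g+a : lookup y ≗ g +ₑ a
    y≗g+a = lookup∘tabulate (g +ₑ a)
    y⊈x : ¬ T (⊆ᵇ E y x)
    y⊈x y⊆x = contradictionᵇ (trans (sym (x≗g a)) (⊆ᵇ-sound y x y⊆x a (trans (y≗g+a a) (+ₑ-new g a)))) ga
    x⊂y : T (isConfigᵇ E y ∧ ⊂ᵇ E x y)
    x⊂y = Equivalence.from T-∧
      ( isConfigᵇ-complete y (IsCfg-resp (sym ∘ y≗g+a) c)
      , Equivalence.from T-∧
          ( ⊆ᵇ-complete x y (λ i xi → trans (y≗g+a i) (+ₑ-old g a (trans (sym (x≗g i)) xi)))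
          , T-not⁺ y⊈x ) )

  Saturated⇒maxConfig : ∀ {g} → IsCfg E g → Saturated E g → ∃ λ k → lookup (maxConfig k) ≗ g
  Saturated⇒maxConfig {g} c sat =
    Any.index x∈M , λ i → trans (cong (λ v → lookup v i) (sym (lookup-index x∈M))) (x≗g i)
    where
    x = tabulate g
    x≗g : lookup x ≗ g
    x≗g = lookup∘tabulate g
    no-larger : ¬ T (any (λ z → isConfigᵇ E z ∧ ⊂ᵇ E x z) (allSubsets E (size E)))
    no-larger h with Any.satisfied (any⁻ (λ z → isConfigᵇ E z ∧ ⊂ᵇ E x z) (allSubsets E (size E)) h)
    ... | y , y-larger with Equivalence.to T-∧ y-larger
    ...   | y-cfg , x⊂y with Equivalence.to T-∧ x⊂y
    ...     | x⊆y , y⊈x = T-not⁻ y⊈x (⊆ᵇ-complete y x y⊆x)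
      where
      y⊆x : ∀ i → lookup y i ≡ true → lookup x i ≡ true
      y⊆x i yi with sat i
      ... | inj₁ gi = trans (x≗g i) gi
      ... | inj₂ (e' , ge' , i#e') = ⊥-elim (IsCfg.conflict-free (isConfigᵇ-sound y y-cfg) i e' yi
              (⊆ᵇ-sound x y x⊆y e' (trans (x≗g e') ge')) i#e')
    x∈M : x ∈ₗ maxConfigs E
    x∈M = ∈-filter⁺ (T? ∘ isMaxConfigᵇ E) (∈-allSubsets x)
      (Equivalence.from T-∧ (isConfigᵇ-complete x (IsCfg-resp (sym ∘ x≗g) c) , T-not⁺ no-larger))

-- The order, conflict and labels are restated over D because those of parES, measES and seqES are
-- defined in where-clauses and cannot be named.
record Decoding {G : Set} {N : ℕ} (E : EvStr G N) (D : Set) : Set where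
  field
    enc       : D → Fin (size E)
    dec       : Fin (size E) → D
    enc∘dec   : ∀ i → enc (dec i) ≡ i
    dec∘enc   : ∀ d → dec (enc d) ≡ d
    _≤ᴰ_ _#ᴰ_ : D → D → Bool
    labelᴰ    : D → Label G N
    enc-≤     : ∀ d d' → _≤ᵉ_ E (enc d) (enc d') ≡ d ≤ᴰ d'
    enc-#     : ∀ d d' → _#ᵉ_ E (enc d) (enc d') ≡ d #ᴰ d'
    enc-label : ∀ d → label E (enc d) ≡ labelᴰ d

  enc-injective : Injective _≡_ _≡_ enc
  enc-injective {d} {d'} p = trans (sym (dec∘enc d)) (trans (cong dec p) (dec∘enc d'))

  ∀-dec : {Q : Fin (size E) → Set} → (∀ d → Q (enc d)) → ∀ e → Q e
  ∀-dec {Q} h e = subst Q (enc∘dec e) (h (dec e))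

  +ₑ-otherᴰ : ∀ f d d' → d' ≢ d → (f +ₑ enc d) (enc d') ≡ f (enc d')
  +ₑ-otherᴰ f d d' d'≢d = +ₑ-other f (enc d) (d'≢d ∘ enc-injective)

  +ₑ-absentᴰ : ∀ f d d' → d' ≢ d → f (enc d') ≡ false → (f +ₑ enc d) (enc d') ≡ false
  +ₑ-absentᴰ f d d' d'≢d fd' = trans (+ₑ-otherᴰ f d d' d'≢d) fd'

  record IsCfgᴰ (h : D → Bool) : Set where
    field
      down-closedᴰ   : ∀ d d' → T (d' ≤ᴰ d) → h d ≡ true → h d' ≡ true
      conflict-freeᴰ : ∀ d d' → h d ≡ true → h d' ≡ true → ¬ T (d #ᴰ d')

  IsCfg⇒IsCfgᴰ : ∀ {f} → IsCfg E f → IsCfgᴰ (f ∘ enc)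
  IsCfg⇒IsCfgᴰ c = record
    { down-closedᴰ   = λ d d' le → down-closed (enc d) (enc d') (subst T (sym (enc-≤ d' d)) le)
    ; conflict-freeᴰ = λ d d' fd fd' d#d' → conflict-free (enc d) (enc d') fd fd' (subst T (sym (enc-# d d')) d#d') }
    where open IsCfg c

  IsCfgᴰ⇒IsCfg : ∀ {f} → IsCfgᴰ (f ∘ enc) → IsCfg E f
  IsCfgᴰ⇒IsCfg c = record
    { down-closed   = ∀-dec λ d → ∀-dec λ d' le → down-closedᴰ d d' (subst T (enc-≤ d' d) le)
    ; conflict-free = ∀-dec λ d → ∀-dec λ d' fd fd' e#e' → conflict-freeᴰ d d' fd fd' (subst T (enc-# d d') e#e') }
    where open IsCfgᴰ c

  conflict-blocks : ∀ {f} d d' → f (enc d') ≡ true → T (d #ᴰ d') → ¬ IsCfg E (f +ₑ enc d)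
  conflict-blocks {f} d d' fd' d#d' c =
    IsCfgᴰ.conflict-freeᴰ (IsCfg⇒IsCfgᴰ c) d d' (+ₑ-new f (enc d)) (+ₑ-old f (enc d) fd') d#d'

  cause-blocks : ∀ {f} d d' → f (enc d') ≡ false → d' ≢ d → T (d' ≤ᴰ d) → ¬ IsCfg E (f +ₑ enc d)
  cause-blocks {f} d d' fd' d'≢d d'≤d c =
    contradictionᵇ (IsCfgᴰ.down-closedᴰ (IsCfg⇒IsCfgᴰ c) d d' d'≤d (+ₑ-new f (enc d))) (+ₑ-absentᴰ f d d' d'≢d fd')

  Saturatedᴰ⇒Saturated : ∀ {f} → (∀ d → f (enc d) ≡ true ⊎ ∃ λ d' → f (enc d') ≡ true × T (d #ᴰ d')) →
                         Saturated E f
  Saturatedᴰ⇒Saturated sat = ∀-dec λ d →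
    Sum.map₂ (λ { (d' , fd' , d#d') → enc d' , fd' , subst T (sym (enc-# d d')) d#d' }) (sat d)

-- An embedded copy of E' inside a decoded structure, e.g. one side of a parallel composition.
record Component {G : Set} {N : ℕ} {E : EvStr G N} {D : Set} (V : Decoding E D) (E' : EvStr G N) : Set where
  field
    inc           : Fin (size E') → D
    inc-injective : Injective _≡_ _≡_ inc
    inc-≤         : ∀ a b → Decoding._≤ᴰ_ V (inc a) (inc b) ≡ _≤ᵉ_ E' a b
    inc-#         : ∀ a b → Decoding._#ᴰ_ V (inc a) (inc b) ≡ _#ᵉ_ E' a b
    inc-label     : ∀ a → Decoding.labelᴰ V (inc a) ≡ label E' a

infixl 8 _↾_

_↾_ : ∀ {G N} {E : EvStr G N} {D} {V : Decoding E D} {E' : EvStr G N} →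
      (Fin (size E) → Bool) → Component V E' → Fin (size E') → Bool
_↾_ {V = V} f K = f ∘ Decoding.enc V ∘ Component.inc K

module _ {G : Set} {N : ℕ} {E : EvStr G N} {D : Set} {V : Decoding E D} {E' : EvStr G N}
         (K : Component V E') where
  open Decoding V
  open Component K

  IsCfg-↾ : ∀ {f} → IsCfg E f → IsCfg E' (f ↾ K)
  IsCfg-↾ c = record
    { down-closed   = λ a a' le → down-closed (enc (inc a)) (enc (inc a'))
                        (subst T (sym (trans (enc-≤ (inc a') (inc a)) (inc-≤ a' a))) le)
    ; conflict-free = λ a a' fa fa' a#a' → conflict-free (enc (inc a)) (enc (inc a')) fa fa'
                        (subst T (sym (trans (enc-# (inc a) (inc a')) (inc-# a a'))) a#a') }
    where open IsCfg c

  +ₑ-↾ : ∀ f a → (f +ₑ enc (inc a)) ↾ K ≗ (f ↾ K) +ₑ a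
  +ₑ-↾ f = +ₑ-∘ (enc ∘ inc) (inc-injective ∘ enc-injective) f

  +ₑ-↾-outside : ∀ f d → (∀ a → inc a ≢ d) → (f +ₑ enc d) ↾ K ≗ f ↾ K
  +ₑ-↾-outside f d outside a = +ₑ-otherᴰ f d (inc a) (outside a)

  IsCfg-+ₑ-↾ : ∀ {f a} → IsCfg E (f +ₑ enc (inc a)) → IsCfg E' ((f ↾ K) +ₑ a)
  IsCfg-+ₑ-↾ {f} {a} c = IsCfg-resp (+ₑ-↾ f a) (IsCfg-↾ c)

  label-↾ : ∀ a → label E (enc (inc a)) ≡ label E' a
  label-↾ a = trans (enc-label (inc a)) (inc-label a)

  Saturated-↾ : ∀ {f} → Saturated E' (f ↾ K) →
                ∀ a → f (enc (inc a)) ≡ true ⊎ ∃ λ d' → f (enc d') ≡ true × T (inc a #ᴰ d')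
  Saturated-↾ sat a =
    Sum.map₂ (λ { (a' , fa' , a#a') → inc a' , fa' , subst T (sym (inc-# a a')) a#a' }) (sat a)

-- Parallel composition

module _ {G : Set} {N : ℕ} (E₁ E₂ : EvStr G N) where
  private
    n₁ = size E₁
    n₂ = size E₂

  parDecoding : Decoding (parES E₁ E₂) (Fin n₁ ⊎ Fin n₂)
  parDecoding = record
    { enc = join n₁ n₂ ; dec = splitAt n₁ ; enc∘dec = join-splitAt n₁ n₂ ; dec∘enc = splitAt-join n₁ n₂
    ; _≤ᴰ_ = le ; _#ᴰ_ = cf ; labelᴰ = lb ; enc-≤ = enc-≤ ; enc-# = enc-# ; enc-label = enc-label }
    where
    le cf : Fin n₁ ⊎ Fin n₂ → Fin n₁ ⊎ Fin n₂ → Bool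
    le (inj₁ a) (inj₁ b) = _≤ᵉ_ E₁ a b
    le (inj₂ a) (inj₂ b) = _≤ᵉ_ E₂ a b
    le _        _        = false
    cf (inj₁ a) (inj₁ b) = _#ᵉ_ E₁ a b
    cf (inj₂ a) (inj₂ b) = _#ᵉ_ E₂ a b
    cf _        _        = false
    lb : Fin n₁ ⊎ Fin n₂ → Label G N
    lb (inj₁ a) = label E₁ a
    lb (inj₂ b) = label E₂ b
    enc-≤ : ∀ d d' → _≤ᵉ_ (parES E₁ E₂) (join n₁ n₂ d) (join n₁ n₂ d') ≡ le d d'
    enc-≤ (inj₁ a) (inj₁ b) rewrite splitAt-↑ˡ n₁ a n₂ | splitAt-↑ˡ n₁ b n₂ = refl
    enc-≤ (inj₁ a) (inj₂ b) rewrite splitAt-↑ˡ n₁ a n₂ | splitAt-↑ʳ n₁ n₂ b = refl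
    enc-≤ (inj₂ a) (inj₁ b) rewrite splitAt-↑ʳ n₁ n₂ a | splitAt-↑ˡ n₁ b n₂ = refl
    enc-≤ (inj₂ a) (inj₂ b) rewrite splitAt-↑ʳ n₁ n₂ a | splitAt-↑ʳ n₁ n₂ b = refl
    enc-# : ∀ d d' → _#ᵉ_ (parES E₁ E₂) (join n₁ n₂ d) (join n₁ n₂ d') ≡ cf d d'
    enc-# (inj₁ a) (inj₁ b) rewrite splitAt-↑ˡ n₁ a n₂ | splitAt-↑ˡ n₁ b n₂ = refl
    enc-# (inj₁ a) (inj₂ b) rewrite splitAt-↑ˡ n₁ a n₂ | splitAt-↑ʳ n₁ n₂ b = refl
    enc-# (inj₂ a) (inj₁ b) rewrite splitAt-↑ʳ n₁ n₂ a | splitAt-↑ˡ n₁ b n₂ = refl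
    enc-# (inj₂ a) (inj₂ b) rewrite splitAt-↑ʳ n₁ n₂ a | splitAt-↑ʳ n₁ n₂ b = refl
    enc-label : ∀ d → label (parES E₁ E₂) (join n₁ n₂ d) ≡ lb d
    enc-label (inj₁ a) rewrite splitAt-↑ˡ n₁ a n₂ = refl
    enc-label (inj₂ b) rewrite splitAt-↑ʳ n₁ n₂ b = refl

  parˡ : Component parDecoding E₁
  parˡ = record { inc = inj₁ ; inc-injective = λ { refl → refl }
                ; inc-≤ = λ _ _ → refl ; inc-# = λ _ _ → refl ; inc-label = λ _ → refl }

  parʳ : Component parDecoding E₂
  parʳ = record { inc = inj₂ ; inc-injective = λ { refl → refl }
                ; inc-≤ = λ _ _ → refl ; inc-# = λ _ _ → refl ; inc-label = λ _ → refl }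

  IsCfg-par : ∀ {f} → IsCfg E₁ (f ↾ parˡ) → IsCfg E₂ (f ↾ parʳ) → IsCfg (parES E₁ E₂) f
  IsCfg-par {f} c₁ c₂ = IsCfgᴰ⇒IsCfg record { down-closedᴰ = dc ; conflict-freeᴰ = cf }
    where
    open Decoding parDecoding
    dc : ∀ d d' → T (d' ≤ᴰ d) → f (enc d) ≡ true → f (enc d') ≡ true
    dc (inj₁ a) (inj₁ a') = IsCfg.down-closed c₁ a a'
    dc (inj₂ b) (inj₂ b') = IsCfg.down-closed c₂ b b'
    cf : ∀ d d' → f (enc d) ≡ true → f (enc d') ≡ true → ¬ T (d #ᴰ d')
    cf (inj₁ a) (inj₁ a') = IsCfg.conflict-free c₁ a a'
    cf (inj₂ b) (inj₂ b') = IsCfg.conflict-free c₂ b b'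

-- Measurement

module _ {G : Set} {N : ℕ} (n : Fin N) (E₁ E₂ : EvStr G N) where
  private
    n₁ = size E₁
    n₂ = size E₂
    Ev = MeasEv {G} {N} n₁ n₂

  encodeMeas : Ev → Fin (size (measES n E₁ E₂))
  encodeMeas τ₀      = zero
  encodeMeas τ₁      = suc zero
  encodeMeas (lft a) = suc (suc (a ↑ˡ n₂))
  encodeMeas (rgt b) = suc (suc (n₁ ↑ʳ b))

  measDecoding : Decoding (measES n E₁ E₂) Ev
  measDecoding = record
    { enc = encodeMeas ; dec = measDecode ; enc∘dec = enc∘dec ; dec∘enc = dec∘enc
    ; _≤ᴰ_ = le ; _#ᴰ_ = cf ; labelᴰ = lb ; enc-≤ = enc-≤ ; enc-# = enc-# ; enc-label = enc-label }
    where
    dec∘enc : ∀ d → measDecode (encodeMeas d) ≡ d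
    dec∘enc τ₀      = refl
    dec∘enc τ₁      = refl
    dec∘enc (lft a) rewrite splitAt-↑ˡ n₁ a n₂ = refl
    dec∘enc (rgt b) rewrite splitAt-↑ʳ n₁ n₂ b = refl
    enc∘dec : ∀ i → encodeMeas (measDecode i) ≡ i
    enc∘dec zero          = refl
    enc∘dec (suc zero)    = refl
    enc∘dec (suc (suc i)) with splitAt n₁ i in eq
    ... | inj₁ a = cong (λ j → suc (suc j)) (splitAt⁻¹-↑ˡ eq)
    ... | inj₂ b = cong (λ j → suc (suc j)) (splitAt⁻¹-↑ʳ eq)
    le cf : Ev → Ev → Bool
    le τ₀      τ₀      = true
    le τ₀      (lft _) = true
    le τ₁      τ₁      = true
    le τ₁      (rgt _) = true
    le (lft a) (lft b) = _≤ᵉ_ E₁ a b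
    le (rgt a) (rgt b) = _≤ᵉ_ E₂ a b
    le _       _       = false
    cf (lft a) (lft b) = _#ᵉ_ E₁ a b
    cf (rgt a) (rgt b) = _#ᵉ_ E₂ a b
    cf u       v       = not ⌊ measSide u ≟ measSide v ⌋
    lb : Ev → Label G N
    lb τ₀      = P zero n
    lb τ₁      = P (suc zero) n
    lb (lft a) = label E₁ a
    lb (rgt b) = label E₂ b
    enc-≤ : ∀ d d' → _≤ᵉ_ (measES n E₁ E₂) (encodeMeas d) (encodeMeas d') ≡ le d d'
    enc-≤ d d' rewrite dec∘enc d | dec∘enc d' with d | d'
    ... | τ₀    | τ₀    = refl
    ... | τ₀    | τ₁    = refl
    ... | τ₀    | lft _ = refl
    ... | τ₀    | rgt _ = refl
    ... | τ₁    | τ₀    = refl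
    ... | τ₁    | τ₁    = refl
    ... | τ₁    | lft _ = refl
    ... | τ₁    | rgt _ = refl
    ... | lft _ | τ₀    = refl
    ... | lft _ | τ₁    = refl
    ... | lft _ | lft _ = refl
    ... | lft _ | rgt _ = refl
    ... | rgt _ | τ₀    = refl
    ... | rgt _ | τ₁    = refl
    ... | rgt _ | lft _ = refl
    ... | rgt _ | rgt _ = refl
    enc-# : ∀ d d' → _#ᵉ_ (measES n E₁ E₂) (encodeMeas d) (encodeMeas d') ≡ cf d d'
    enc-# d d' rewrite dec∘enc d | dec∘enc d' with d | d'
    ... | τ₀    | _     = refl
    ... | τ₁    | _     = refl
    ... | lft _ | τ₀    = refl
    ... | lft _ | τ₁    = refl
    ... | lft _ | lft _ = refl
    ... | lft _ | rgt _ = refl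
    ... | rgt _ | τ₀    = refl
    ... | rgt _ | τ₁    = refl
    ... | rgt _ | lft _ = refl
    ... | rgt _ | rgt _ = refl
    enc-label : ∀ d → label (measES n E₁ E₂) (encodeMeas d) ≡ lb d
    enc-label d rewrite dec∘enc d with d
    ... | τ₀    = refl
    ... | τ₁    = refl
    ... | lft _ = refl
    ... | rgt _ = refl

  branch₀ : Component measDecoding E₁
  branch₀ = record { inc = lft ; inc-injective = λ { refl → refl }
                   ; inc-≤ = λ _ _ → refl ; inc-# = λ _ _ → refl ; inc-label = λ _ → refl }

  branch₁ : Component measDecoding E₂
  branch₁ = record { inc = rgt ; inc-injective = λ { refl → refl }
                   ; inc-≤ = λ _ _ → refl ; inc-# = λ _ _ → refl ; inc-label = λ _ → refl }

  IsCfg-branch₀ : ∀ {f} → f (encodeMeas τ₀) ≡ true → f (encodeMeas τ₁) ≡ false →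
                  (∀ b → (f ↾ branch₁) b ≡ false) → IsCfg E₁ (f ↾ branch₀) → IsCfg (measES n E₁ E₂) f
  IsCfg-branch₀ {f} f₀ f₁ f₂ c₁ = IsCfgᴰ⇒IsCfg record { down-closedᴰ = dc ; conflict-freeᴰ = cf }
    where
    open Decoding measDecoding
    dc : ∀ d d' → T (d' ≤ᴰ d) → f (enc d) ≡ true → f (enc d') ≡ true
    dc τ₀      τ₀       _  _ = f₀
    dc (lft a) τ₀       _  _ = f₀
    dc (lft a) (lft a') le p = IsCfg.down-closed c₁ a a' le p
    dc τ₁      _        _  p = contradictionᵇ p f₁
    dc (rgt b) _        _  p = contradictionᵇ p (f₂ b)
    cf : ∀ d d' → f (enc d) ≡ true → f (enc d') ≡ true → ¬ T (d #ᴰ d')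
    cf (lft a) (lft a') = IsCfg.conflict-free c₁ a a'
    cf τ₁      _        p = contradictionᵇ p f₁
    cf (rgt b) _        p = contradictionᵇ p (f₂ b)
    cf _       τ₁       _ p = contradictionᵇ p f₁
    cf _       (rgt b)  _ p = contradictionᵇ p (f₂ b)

  IsCfg-branch₁ : ∀ {f} → f (encodeMeas τ₁) ≡ true → f (encodeMeas τ₀) ≡ false →
                  (∀ a → (f ↾ branch₀) a ≡ false) → IsCfg E₂ (f ↾ branch₁) → IsCfg (measES n E₁ E₂) f
  IsCfg-branch₁ {f} f₁ f₀ f₂ c₂ = IsCfgᴰ⇒IsCfg record { down-closedᴰ = dc ; conflict-freeᴰ = cf }
    where
    open Decoding measDecoding
    dc : ∀ d d' → T (d' ≤ᴰ d) → f (enc d) ≡ true → f (enc d') ≡ true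
    dc τ₁      τ₁       _  _ = f₁
    dc (rgt b) τ₁       _  _ = f₁
    dc (rgt b) (rgt b') le p = IsCfg.down-closed c₂ b b' le p
    dc τ₀      _        _  p = contradictionᵇ p f₀
    dc (lft a) _        _  p = contradictionᵇ p (f₂ a)
    cf : ∀ d d' → f (enc d) ≡ true → f (enc d') ≡ true → ¬ T (d #ᴰ d')
    cf (rgt b) (rgt b') = IsCfg.conflict-free c₂ b b'
    cf τ₀      _        p = contradictionᵇ p f₀
    cf (lft a) _        p = contradictionᵇ p (f₂ a)
    cf _       τ₀       _ p = contradictionᵇ p f₀
    cf _       (lft a)  _ p = contradictionᵇ p (f₂ a)

-- Sequential composition

module _ {G : Set} {N : ℕ} (E₁ E₂ : EvStr G N) where
  private
    n₁ = size E₁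
    n₂ = size E₂
    M  = maxConfigs E₁
    Ev = SeqEv {G} {N} n₁ n₂ M

  encodeSeq : Ev → Fin (size (seqES E₁ E₂))
  encodeSeq (fst a)   = a ↑ˡ (n₂ * length M)
  encodeSeq (snd b k) = n₁ ↑ʳ combine b k

  seqDecoding : Decoding (seqES E₁ E₂) Ev
  seqDecoding = record
    { enc = encodeSeq ; dec = seqDecode M ; enc∘dec = enc∘dec ; dec∘enc = dec∘enc
    ; _≤ᴰ_ = le ; _#ᴰ_ = cf ; labelᴰ = lb ; enc-≤ = enc-≤ ; enc-# = enc-# ; enc-label = enc-label }
    where
    dec∘enc : ∀ d → seqDecode M (encodeSeq d) ≡ d
    dec∘enc (fst a) rewrite splitAt-↑ˡ n₁ a (n₂ * length M) = refl
    dec∘enc (snd b k) rewrite splitAt-↑ʳ n₁ (n₂ * length M) (combine b k) =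
      cong (λ p → snd (proj₁ p) (proj₂ p)) (remQuot-combine {n₂} {length M} b k)
    enc∘dec : ∀ i → encodeSeq (seqDecode M i) ≡ i
    enc∘dec i with splitAt n₁ i in eq
    ... | inj₁ a = splitAt⁻¹-↑ˡ eq
    ... | inj₂ j = trans (cong (n₁ ↑ʳ_) (combine-remQuot {n₂} (length M) j)) (splitAt⁻¹-↑ʳ eq)
    le cf : Ev → Ev → Bool
    le (fst a)   (fst b)     = _≤ᵉ_ E₁ a b
    le (fst a)   (snd _ k)   = lookup (maxConfig E₁ k) a
    le (snd _ _) (fst _)     = false
    le (snd b k) (snd b' k') = ⌊ k ≟ k' ⌋ ∧ _≤ᵉ_ E₂ b b'
    cf (fst a)   (fst b)     = _#ᵉ_ E₁ a b
    cf (fst a)   (snd _ k)   = not (lookup (maxConfig E₁ k) a)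
    cf (snd _ k) (fst a)     = not (lookup (maxConfig E₁ k) a)
    cf (snd b k) (snd b' k') = not ⌊ k ≟ k' ⌋ ∨ _#ᵉ_ E₂ b b'
    lb : Ev → Label G N
    lb (fst a)   = label E₁ a
    lb (snd b _) = label E₂ b
    enc-≤ : ∀ d d' → _≤ᵉ_ (seqES E₁ E₂) (encodeSeq d) (encodeSeq d') ≡ le d d'
    enc-≤ d d' rewrite dec∘enc d | dec∘enc d' with d | d'
    ... | fst _   | fst _   = refl
    ... | fst _   | snd _ _ = refl
    ... | snd _ _ | fst _   = refl
    ... | snd _ _ | snd _ _ = refl
    enc-# : ∀ d d' → _#ᵉ_ (seqES E₁ E₂) (encodeSeq d) (encodeSeq d') ≡ cf d d'
    enc-# d d' rewrite dec∘enc d | dec∘enc d' with d | d'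
    ... | fst _   | fst _   = refl
    ... | fst _   | snd _ _ = refl
    ... | snd _ _ | fst _   = refl
    ... | snd _ _ | snd _ _ = refl
    enc-label : ∀ d → label (seqES E₁ E₂) (encodeSeq d) ≡ lb d
    enc-label d rewrite dec∘enc d with d
    ... | fst _   = refl
    ... | snd _ _ = refl

  open Decoding seqDecoding

  seqFirst : Component seqDecoding E₁
  seqFirst = record { inc = fst ; inc-injective = λ { refl → refl }
                    ; inc-≤ = λ _ _ → refl ; inc-# = λ _ _ → refl ; inc-label = λ _ → refl }

  -- The copy of E₂ that follows the k-th maximal configuration of E₁.
  seqColumn : Fin (length M) → Component seqDecoding E₂
  seqColumn k = record
    { inc = λ b → snd b k ; inc-injective = λ { refl → refl }
    ; inc-≤ = λ b b' → cong (_∧ _≤ᵉ_ E₂ b b') (⌊⌋-yes (k ≟ k) refl)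
    ; inc-# = λ b b' → cong (λ z → not z ∨ _#ᵉ_ E₂ b b') (⌊⌋-yes (k ≟ k) refl)
    ; inc-label = λ _ → refl }

  IsCfg-seqFirst : ∀ {f} → (∀ k b → (f ↾ seqColumn k) b ≡ false) → IsCfg E₁ (f ↾ seqFirst) →
                   IsCfg (seqES E₁ E₂) f
  IsCfg-seqFirst {f} f₂ c₁ = IsCfgᴰ⇒IsCfg record { down-closedᴰ = dc ; conflict-freeᴰ = cf }
    where
    dc : ∀ d d' → T (d' ≤ᴰ d) → f (enc d) ≡ true → f (enc d') ≡ true
    dc (fst a)   (fst a') = IsCfg.down-closed c₁ a a'
    dc (snd b k) _        _ p = contradictionᵇ p (f₂ k b)
    cf : ∀ d d' → f (enc d) ≡ true → f (enc d') ≡ true → ¬ T (d #ᴰ d')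
    cf (fst a)   (fst a')  = IsCfg.conflict-free c₁ a a'
    cf (fst a)   (snd b k) _ p = contradictionᵇ p (f₂ k b)
    cf (snd b k) _         p   = contradictionᵇ p (f₂ k b)

  IsCfg-seqColumn : ∀ {f} k → f ↾ seqFirst ≗ lookup (maxConfig E₁ k) →
                    (∀ k' → k' ≢ k → ∀ b → (f ↾ seqColumn k') b ≡ false) → IsCfg E₂ (f ↾ seqColumn k) →
                    IsCfg (seqES E₁ E₂) f
  IsCfg-seqColumn {f} k f₁ f₂ c₂ = IsCfgᴰ⇒IsCfg record { down-closedᴰ = dc ; conflict-freeᴰ = cf }
    where
    c₁ : IsCfg E₁ (f ↾ seqFirst)
    c₁ = IsCfg-resp (sym ∘ f₁) (maxConfig-IsCfg E₁ k)
    dc : ∀ d d' → T (d' ≤ᴰ d) → f (enc d) ≡ true → f (enc d') ≡ true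
    dc (fst a) (fst a') = IsCfg.down-closed c₁ a a'
    dc (snd b k₁) d' le p with k₁ ≟ k
    ... | no k₁≢k = contradictionᵇ p (f₂ k₁ k₁≢k b)
    dc (snd b k) (fst a) le p | yes refl = trans (f₁ a) (Equivalence.to T-≡ le)
    dc (snd b k) (snd b' k₂) le p | yes refl with k₂ ≟ k
    ... | yes refl = IsCfg.down-closed c₂ b b' le p
    ... | no _     = ⊥-elim le
    cf : ∀ d d' → f (enc d) ≡ true → f (enc d') ≡ true → ¬ T (d #ᴰ d')
    cf (fst a) (fst a') = IsCfg.conflict-free c₁ a a'
    cf (fst a) (snd b k₁) p q with k₁ ≟ k
    ... | no k₁≢k  = contradictionᵇ q (f₂ k₁ k₁≢k b)
    ... | yes refl = T-not-true (trans (sym (f₁ a)) p)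
    cf (snd b k₁) (fst a) p q with k₁ ≟ k
    ... | no k₁≢k  = contradictionᵇ p (f₂ k₁ k₁≢k b)
    ... | yes refl = T-not-true (trans (sym (f₁ a)) q)
    cf (snd b k₁) (snd b' k₂) p q with k₁ ≟ k | k₂ ≟ k
    ... | no k₁≢k | _       = contradictionᵇ p (f₂ k₁ k₁≢k b)
    ... | yes _   | no k₂≢k = contradictionᵇ q (f₂ k₂ k₂≢k b')
    ... | yes refl | yes refl =
      IsCfg.conflict-free c₂ b b' p q ∘ subst T (Component.inc-# (seqColumn k) b b')

  seqColumn-forces : ∀ {f} → IsCfg (seqES E₁ E₂) f → ∀ k b → (f ↾ seqColumn k) b ≡ true →
                     f ↾ seqFirst ≗ lookup (maxConfig E₁ k)
  seqColumn-forces {f} c k b fb a with lookup (maxConfig E₁ k) a in eq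
  ... | true  = IsCfgᴰ.down-closedᴰ (IsCfg⇒IsCfgᴰ c) (snd b k) (fst a) (Equivalence.from T-≡ eq) fb
  ... | false with f (enc (fst a)) in fa
  ...   | false = refl
  ...   | true  =
    ⊥-elim (IsCfgᴰ.conflict-freeᴰ (IsCfg⇒IsCfgᴰ c) (fst a) (snd b k) fa fb (subst (T ∘ not) (sym eq) tt))

-- Residual commands of configurations

module _ {G : Set} {N : ℕ} where

  infixr 5 _∥ᴿ_

  _∥ᴿ_ : Res G N → Res G N → Res G N
  ✓     ∥ᴿ R     = R
  ⟨ C ⟩ ∥ᴿ ✓     = ⟨ C ⟩
  ⟨ C ⟩ ∥ᴿ ⟨ D ⟩ = ⟨ C ∥ D ⟩

  ∥ᴿ-stepˡ : ∀ {C C₁ R₁ R₂ l} → ⟨ C ⟩ ≡ ⟨ C₁ ⟩ ∥ᴿ R₂ → C₁ —[ l ]→ R₁ →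
             ∃ λ R → (C —[ l ]→ R) × R ≡ R₁ ∥ᴿ R₂
  ∥ᴿ-stepˡ {R₁ = ✓}      {⟨ C₂ ⟩} refl t = ⟨ C₂ ⟩ , parL✓ t , refl
  ∥ᴿ-stepˡ {R₁ = ⟨ C₁' ⟩} {⟨ C₂ ⟩} refl t = ⟨ C₁' ∥ C₂ ⟩ , parL→ t , refl
  ∥ᴿ-stepˡ {R₁ = ✓}      {✓}      refl t = ✓ , t , refl
  ∥ᴿ-stepˡ {R₁ = ⟨ C₁' ⟩} {✓}      refl t = ⟨ C₁' ⟩ , t , refl

  ∥ᴿ-stepʳ : ∀ {C C₂ R₁ R₂ l} → ⟨ C ⟩ ≡ R₁ ∥ᴿ ⟨ C₂ ⟩ → C₂ —[ l ]→ R₂ →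
             ∃ λ R → (C —[ l ]→ R) × R ≡ R₁ ∥ᴿ R₂
  ∥ᴿ-stepʳ {R₁ = ⟨ C₁ ⟩} {✓}      refl t = ⟨ C₁ ⟩ , parR✓ t , refl
  ∥ᴿ-stepʳ {R₁ = ⟨ C₁ ⟩} {⟨ C₂' ⟩} refl t = ⟨ C₁ ∥ C₂' ⟩ , parR→ t , refl
  ∥ᴿ-stepʳ {R₁ = ✓}      {R₂}     refl t = R₂ , t , refl

  data Residual : (C : Cmd G N) → (Fin (size ⟦ C ⟧) → Bool) → Res G N → Set where
    skip-pending : ∀ {f} → f zero ≡ false → Residual skip f ⟨ skip ⟩
    skip-done    : ∀ {f} → f zero ≡ true → Residual skip f ✓
    gate-pending : ∀ {u qs f} → f zero ≡ false → Residual (gate u qs) f ⟨ gate u qs ⟩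
    gate-done    : ∀ {u qs f} → f zero ≡ true → Residual (gate u qs) f ✓
    par          : ∀ {C₁ C₂ f R₁ R₂ R} →
                   Residual C₁ (f ↾ parˡ ⟦ C₁ ⟧ ⟦ C₂ ⟧) R₁ → Residual C₂ (f ↾ parʳ ⟦ C₁ ⟧ ⟦ C₂ ⟧) R₂ →
                   R ≡ R₁ ∥ᴿ R₂ → Residual (C₁ ∥ C₂) f R
    unmeasured   : ∀ {n C₁ C₂ f} → (∀ i → f i ≡ false) → Residual (meas n C₁ C₂) f ⟨ meas n C₁ C₂ ⟩
    measured₀    : ∀ {n C₁ C₂ f R} →
                   f (encodeMeas n ⟦ C₁ ⟧ ⟦ C₂ ⟧ τ₀) ≡ true → f (encodeMeas n ⟦ C₁ ⟧ ⟦ C₂ ⟧ τ₁) ≡ false →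
                   (∀ b → (f ↾ branch₁ n ⟦ C₁ ⟧ ⟦ C₂ ⟧) b ≡ false) →
                   Residual C₁ (f ↾ branch₀ n ⟦ C₁ ⟧ ⟦ C₂ ⟧) R → Residual (meas n C₁ C₂) f R
    measured₁    : ∀ {n C₁ C₂ f R} →
                   f (encodeMeas n ⟦ C₁ ⟧ ⟦ C₂ ⟧ τ₁) ≡ true → f (encodeMeas n ⟦ C₁ ⟧ ⟦ C₂ ⟧ τ₀) ≡ false →
                   (∀ a → (f ↾ branch₀ n ⟦ C₁ ⟧ ⟦ C₂ ⟧) a ≡ false) →
                   Residual C₂ (f ↾ branch₁ n ⟦ C₁ ⟧ ⟦ C₂ ⟧) R → Residual (meas n C₁ C₂) f R
    first        : ∀ {C₁ C₂ f C₁'} →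
                   Residual C₁ (f ↾ seqFirst ⟦ C₁ ⟧ ⟦ C₂ ⟧) ⟨ C₁' ⟩ →
                   (∀ k b → (f ↾ seqColumn ⟦ C₁ ⟧ ⟦ C₂ ⟧ k) b ≡ false) → Residual (C₁ ⨾ C₂) f ⟨ C₁' ⨾ C₂ ⟩
    second       : ∀ {C₁ C₂ f R} k →
                   f ↾ seqFirst ⟦ C₁ ⟧ ⟦ C₂ ⟧ ≗ lookup (maxConfig ⟦ C₁ ⟧ k) →
                   (∀ k' → k' ≢ k → ∀ b → (f ↾ seqColumn ⟦ C₁ ⟧ ⟦ C₂ ⟧ k') b ≡ false) →
                   Residual C₂ (f ↾ seqColumn ⟦ C₁ ⟧ ⟦ C₂ ⟧ k) R → Residual (C₁ ⨾ C₂) f R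

  Residual-resp : ∀ {C f g R} → f ≗ g → Residual C f R → Residual C g R
  Residual-resp f≗g (skip-pending p)         = skip-pending (trans (sym (f≗g _)) p)
  Residual-resp f≗g (skip-done p)            = skip-done (trans (sym (f≗g _)) p)
  Residual-resp f≗g (gate-pending p)         = gate-pending (trans (sym (f≗g _)) p)
  Residual-resp f≗g (gate-done p)            = gate-done (trans (sym (f≗g _)) p)
  Residual-resp f≗g (par s₁ s₂ eq)           =
    par (Residual-resp (f≗g ∘ _) s₁) (Residual-resp (f≗g ∘ _) s₂) eq
  Residual-resp f≗g (unmeasured p)           = unmeasured (λ i → trans (sym (f≗g i)) (p i))
  Residual-resp f≗g (measured₀ p₀ p₁ p₂ s)   =
    measured₀ (trans (sym (f≗g _)) p₀) (trans (sym (f≗g _)) p₁) (λ b → trans (sym (f≗g _)) (p₂ b))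
              (Residual-resp (f≗g ∘ _) s)
  Residual-resp f≗g (measured₁ p₁ p₀ p₂ s)   =
    measured₁ (trans (sym (f≗g _)) p₁) (trans (sym (f≗g _)) p₀) (λ a → trans (sym (f≗g _)) (p₂ a))
              (Residual-resp (f≗g ∘ _) s)
  Residual-resp f≗g (first s p)              =
    first (Residual-resp (f≗g ∘ _) s) (λ k b → trans (sym (f≗g _)) (p k b))
  Residual-resp f≗g (second k p₁ p₂ s)       =
    second k (λ a → trans (sym (f≗g _)) (p₁ a)) (λ k' k'≢k b → trans (sym (f≗g _)) (p₂ k' k'≢k b))
           (Residual-resp (f≗g ∘ _) s)

  Residual-initial : ∀ C → Residual C (const false) ⟨ C ⟩
  Residual-initial skip           = skip-pending refl
  Residual-initial (gate _ _)     = gate-pending refl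
  Residual-initial (C₁ ∥ C₂)      = par (Residual-initial C₁) (Residual-initial C₂) refl
  Residual-initial (meas _ _ _)   = unmeasured (λ _ → refl)
  Residual-initial (C₁ ⨾ C₂)      = first (Residual-initial C₁) (λ _ _ → refl)

  someEvent : (C : Cmd G N) → Fin (size ⟦ C ⟧)
  someEvent skip           = zero
  someEvent (gate _ _)     = zero
  someEvent (C₁ ∥ C₂)      = Decoding.enc (parDecoding ⟦ C₁ ⟧ ⟦ C₂ ⟧) (inj₁ (someEvent C₁))
  someEvent (meas n C₁ C₂) = encodeMeas n ⟦ C₁ ⟧ ⟦ C₂ ⟧ τ₀
  someEvent (C₁ ⨾ C₂)      = encodeSeq ⟦ C₁ ⟧ ⟦ C₂ ⟧ (fst (someEvent C₁))

  Residual-✓⇒Saturated : ∀ C {f} → Residual C f ✓ → Saturated ⟦ C ⟧ f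
  Residual-✓⇒Saturated skip       (skip-done p) zero = inj₁ p
  Residual-✓⇒Saturated (gate _ _) (gate-done p) zero = inj₁ p
  Residual-✓⇒Saturated (C₁ ∥ C₂) {f} (par {R₁ = ✓} {✓} s₁ s₂ _) =
    Saturatedᴰ⇒Saturated {f} λ { (inj₁ a) → Saturated-↾ (parˡ ⟦ C₁ ⟧ ⟦ C₂ ⟧) {f} (Residual-✓⇒Saturated C₁ s₁) a
                               ; (inj₂ b) → Saturated-↾ (parʳ ⟦ C₁ ⟧ ⟦ C₂ ⟧) {f} (Residual-✓⇒Saturated C₂ s₂) b }
    where open Decoding (parDecoding ⟦ C₁ ⟧ ⟦ C₂ ⟧)
  Residual-✓⇒Saturated (C₁ ∥ C₂) (par {R₁ = ✓}     {⟨ _ ⟩} _ _ ())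
  Residual-✓⇒Saturated (C₁ ∥ C₂) (par {R₁ = ⟨ _ ⟩} {✓}     _ _ ())
  Residual-✓⇒Saturated (C₁ ∥ C₂) (par {R₁ = ⟨ _ ⟩} {⟨ _ ⟩} _ _ ())
  Residual-✓⇒Saturated (meas n C₁ C₂) {f} (measured₀ p₀ _ _ s) =
    Saturatedᴰ⇒Saturated {f} λ { τ₀      → inj₁ p₀
                               ; τ₁      → inj₂ (τ₀ , p₀ , tt)
                               ; (rgt _) → inj₂ (τ₀ , p₀ , tt)
                               ; (lft a) → Saturated-↾ (branch₀ n ⟦ C₁ ⟧ ⟦ C₂ ⟧) {f} (Residual-✓⇒Saturated C₁ s) a }
    where open Decoding (measDecoding n ⟦ C₁ ⟧ ⟦ C₂ ⟧)
  Residual-✓⇒Saturated (meas n C₁ C₂) {f} (measured₁ p₁ _ _ s) =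
    Saturatedᴰ⇒Saturated {f} λ { τ₁      → inj₁ p₁
                               ; τ₀      → inj₂ (τ₁ , p₁ , tt)
                               ; (lft _) → inj₂ (τ₁ , p₁ , tt)
                               ; (rgt b) → Saturated-↾ (branch₁ n ⟦ C₁ ⟧ ⟦ C₂ ⟧) {f} (Residual-✓⇒Saturated C₂ s) b }
    where open Decoding (measDecoding n ⟦ C₁ ⟧ ⟦ C₂ ⟧)
  Residual-✓⇒Saturated (C₁ ⨾ C₂) {f} (second k p₁ _ s) = Saturatedᴰ⇒Saturated {f} sat
    where
    open Decoding (seqDecoding ⟦ C₁ ⟧ ⟦ C₂ ⟧)
    sat₂ : Saturated ⟦ C₂ ⟧ (f ↾ seqColumn ⟦ C₁ ⟧ ⟦ C₂ ⟧ k)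
    sat₂ = Residual-✓⇒Saturated C₂ s
    -- E₂ is non-empty, so the k-th column contains an event of f, which conflicts with every other column
    -- and with every event of E₁ outside the k-th maximal configuration.
    witness = Saturated-witness {E = ⟦ C₂ ⟧} {f ↾ seqColumn ⟦ C₁ ⟧ ⟦ C₂ ⟧ k} sat₂ (someEvent C₂)
    b₀ = proj₁ witness
    fb₀ = proj₂ witness
    sat : ∀ d → f (enc d) ≡ true ⊎ ∃ λ d' → f (enc d') ≡ true × T (d #ᴰ d')
    sat (fst a) with lookup (maxConfig ⟦ C₁ ⟧ k) a in eq
    ... | true  = inj₁ (trans (p₁ a) eq)
    ... | false = inj₂ (snd b₀ k , fb₀ , subst (T ∘ not) (sym eq) tt)
    sat (snd b k') with k' ≟ k
    ... | yes refl = Saturated-↾ (seqColumn ⟦ C₁ ⟧ ⟦ C₂ ⟧ k) {f} sat₂ b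
    ... | no k'≢k  = inj₂ (snd b₀ k , fb₀ , subst (λ z → T (not z ∨ _)) (sym (⌊⌋-no (k' ≟ k) k'≢k)) tt)

  IsCfg-single : ∀ l g → IsCfg (single {G} {N} l) g
  IsCfg-single l g = record { down-closed = λ { zero zero _ p → p } ; conflict-free = λ _ _ _ _ () }

  Residual-running⇒extendable : ∀ C {f C'} → Residual C f ⟨ C' ⟩ → IsCfg ⟦ C ⟧ f →
                                ∃ λ e → f e ≡ false × IsCfg ⟦ C ⟧ (f +ₑ e)
  Residual-running⇒extendable skip       (skip-pending p) _ = zero , p , IsCfg-single _ _
  Residual-running⇒extendable (gate _ _) (gate-pending p) _ = zero , p , IsCfg-single _ _
  Residual-running⇒extendable (C₁ ∥ C₂) {f} (par {R₁ = ⟨ _ ⟩} s₁ _ _) c =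
    let a , fa , c₁ = Residual-running⇒extendable C₁ s₁ (IsCfg-↾ L c) in
    enc (inj₁ a) , fa ,
    IsCfg-par ⟦ C₁ ⟧ ⟦ C₂ ⟧ (IsCfg-resp (sym ∘ +ₑ-↾ L f a) c₁)
                            (IsCfg-resp (sym ∘ +ₑ-↾-outside R f (inj₁ a) (λ _ ())) (IsCfg-↾ R c))
    where open Decoding (parDecoding ⟦ C₁ ⟧ ⟦ C₂ ⟧)
          L = parˡ ⟦ C₁ ⟧ ⟦ C₂ ⟧
          R = parʳ ⟦ C₁ ⟧ ⟦ C₂ ⟧
  Residual-running⇒extendable (C₁ ∥ C₂) {f} (par {R₁ = ✓} {⟨ _ ⟩} _ s₂ _) c =
    let b , fb , c₂ = Residual-running⇒extendable C₂ s₂ (IsCfg-↾ R c) in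
    enc (inj₂ b) , fb ,
    IsCfg-par ⟦ C₁ ⟧ ⟦ C₂ ⟧ (IsCfg-resp (sym ∘ +ₑ-↾-outside L f (inj₂ b) (λ _ ())) (IsCfg-↾ L c))
                            (IsCfg-resp (sym ∘ +ₑ-↾ R f b) c₂)
    where open Decoding (parDecoding ⟦ C₁ ⟧ ⟦ C₂ ⟧)
          L = parˡ ⟦ C₁ ⟧ ⟦ C₂ ⟧
          R = parʳ ⟦ C₁ ⟧ ⟦ C₂ ⟧
  Residual-running⇒extendable (C₁ ∥ C₂) (par {R₁ = ✓} {✓} _ _ ()) _
  Residual-running⇒extendable (meas n C₁ C₂) {f} (unmeasured p) _ =
    enc τ₀ , p _ ,
    IsCfg-branch₀ n ⟦ C₁ ⟧ ⟦ C₂ ⟧ (+ₑ-new f _) (+ₑ-absentᴰ f τ₀ τ₁ (λ ()) (p _))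
      (λ b → +ₑ-absentᴰ f τ₀ (rgt b) (λ ()) (p _))
      (IsCfg-resp (λ a → sym (+ₑ-absentᴰ f τ₀ (lft a) (λ ()) (p _))) IsCfg-∅)
    where open Decoding (measDecoding n ⟦ C₁ ⟧ ⟦ C₂ ⟧)
  Residual-running⇒extendable (meas n C₁ C₂) {f} (measured₀ p₀ p₁ p₂ s) c =
    let a , fa , c₁ = Residual-running⇒extendable C₁ s (IsCfg-↾ B₀ c) in
    enc (lft a) , fa ,
    IsCfg-branch₀ n ⟦ C₁ ⟧ ⟦ C₂ ⟧ (+ₑ-old f (enc (lft a)) p₀) (+ₑ-absentᴰ f (lft a) τ₁ (λ ()) p₁)
      (λ b → +ₑ-absentᴰ f (lft a) (rgt b) (λ ()) (p₂ b))
      (IsCfg-resp (sym ∘ +ₑ-↾ B₀ f a) c₁)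
    where open Decoding (measDecoding n ⟦ C₁ ⟧ ⟦ C₂ ⟧)
          B₀ = branch₀ n ⟦ C₁ ⟧ ⟦ C₂ ⟧
  Residual-running⇒extendable (meas n C₁ C₂) {f} (measured₁ p₁ p₀ p₂ s) c =
    let b , fb , c₂ = Residual-running⇒extendable C₂ s (IsCfg-↾ B₁ c) in
    enc (rgt b) , fb ,
    IsCfg-branch₁ n ⟦ C₁ ⟧ ⟦ C₂ ⟧ (+ₑ-old f (enc (rgt b)) p₁) (+ₑ-absentᴰ f (rgt b) τ₀ (λ ()) p₀)
      (λ a → +ₑ-absentᴰ f (rgt b) (lft a) (λ ()) (p₂ a))
      (IsCfg-resp (sym ∘ +ₑ-↾ B₁ f b) c₂)
    where open Decoding (measDecoding n ⟦ C₁ ⟧ ⟦ C₂ ⟧)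
          B₁ = branch₁ n ⟦ C₁ ⟧ ⟦ C₂ ⟧
  Residual-running⇒extendable (C₁ ⨾ C₂) {f} (first s p) c =
    let a , fa , c₁ = Residual-running⇒extendable C₁ s (IsCfg-↾ S₁ c) in
    enc (fst a) , fa ,
    IsCfg-seqFirst ⟦ C₁ ⟧ ⟦ C₂ ⟧ (λ k b → +ₑ-absentᴰ f (fst a) (snd b k) (λ ()) (p k b))
      (IsCfg-resp (sym ∘ +ₑ-↾ S₁ f a) c₁)
    where open Decoding (seqDecoding ⟦ C₁ ⟧ ⟦ C₂ ⟧)
          S₁ = seqFirst ⟦ C₁ ⟧ ⟦ C₂ ⟧
  Residual-running⇒extendable (C₁ ⨾ C₂) {f} (second k p₁ p₂ s) c =
    let b , fb , c₂ = Residual-running⇒extendable C₂ s (IsCfg-↾ Sₖ c) in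
    enc (snd b k) , fb ,
    IsCfg-seqColumn ⟦ C₁ ⟧ ⟦ C₂ ⟧ k (λ a → trans (+ₑ-otherᴰ f (snd b k) (fst a) (λ ())) (p₁ a))
      (λ k' k'≢k b' → +ₑ-absentᴰ f (snd b k) (snd b' k') (λ { refl → k'≢k refl }) (p₂ k' k'≢k b'))
      (IsCfg-resp (sym ∘ +ₑ-↾ Sₖ f b) c₂)
    where open Decoding (seqDecoding ⟦ C₁ ⟧ ⟦ C₂ ⟧)
          Sₖ = seqColumn ⟦ C₁ ⟧ ⟦ C₂ ⟧ k

  StepAt : (C : Cmd G N) → Fin (size ⟦ C ⟧) → Set
  StepAt C e = ∀ {f C'} → Residual C f ⟨ C' ⟩ → IsCfg ⟦ C ⟧ f → f e ≡ false → IsCfg ⟦ C ⟧ (f +ₑ e) →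
               ∃ λ R → (C' —[ label ⟦ C ⟧ e ]→ R) × Residual C (f +ₑ e) R

  step-↾ : ∀ {C₁ : Cmd G N} {E : EvStr G N} {D : Set} {V : Decoding E D} (K : Component V ⟦ C₁ ⟧) →
           (∀ a → StepAt C₁ a) → ∀ a → let e = Decoding.enc V (Component.inc K a) in
           ∀ {f C₁'} → Residual C₁ (f ↾ K) ⟨ C₁' ⟩ → IsCfg E f → f e ≡ false → IsCfg E (f +ₑ e) →
           ∃ λ R → (C₁' —[ label E e ]→ R) × Residual C₁ ((f +ₑ e) ↾ K) R
  step-↾ K sim a {f} s c fa c' =
    let R , t , s' = sim a s (IsCfg-↾ K c) fa (IsCfg-+ₑ-↾ K c') in
    R , subst (λ l → _ —[ l ]→ R) (sym (label-↾ K a)) t , Residual-resp (sym ∘ +ₑ-↾ K f a) s'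

  step-par : ∀ {C₁ C₂} → (∀ a → StepAt C₁ a) → (∀ b → StepAt C₂ b) → ∀ e → StepAt (C₁ ∥ C₂) e
  step-par {C₁} {C₂} sim₁ sim₂ = ∀-dec step
    where
    open Decoding (parDecoding ⟦ C₁ ⟧ ⟦ C₂ ⟧)
    Kˡ = parˡ ⟦ C₁ ⟧ ⟦ C₂ ⟧
    Kʳ = parʳ ⟦ C₁ ⟧ ⟦ C₂ ⟧
    step : ∀ d → StepAt (C₁ ∥ C₂) (enc d)
    step (inj₁ a) (par {R₁ = ✓} s₁ _ _) _ fa c' =
      ⊥-elim (Saturated⇒unextendable (Residual-✓⇒Saturated C₁ s₁) fa (IsCfg-+ₑ-↾ Kˡ c'))
    step (inj₁ a) {f} (par {R₁ = ⟨ _ ⟩} s₁ s₂ eq) c fa c' =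
      let R₁ , t , s₁' = step-↾ Kˡ sim₁ a s₁ c fa c'
          R , t' , eq' = ∥ᴿ-stepˡ eq t
      in R , t' , par s₁' (Residual-resp (sym ∘ +ₑ-↾-outside Kʳ f (inj₁ a) (λ _ ())) s₂) eq'
    step (inj₂ b) (par {R₂ = ✓} _ s₂ _) _ fb c' =
      ⊥-elim (Saturated⇒unextendable (Residual-✓⇒Saturated C₂ s₂) fb (IsCfg-+ₑ-↾ Kʳ c'))
    step (inj₂ b) {f} (par {R₂ = ⟨ _ ⟩} s₁ s₂ eq) c fb c' =
      let R₂ , t , s₂' = step-↾ Kʳ sim₂ b s₂ c fb c'
          R , t' , eq' = ∥ᴿ-stepʳ eq t
      in R , t' , par (Residual-resp (sym ∘ +ₑ-↾-outside Kˡ f (inj₂ b) (λ _ ())) s₁) s₂' eq'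

  step-meas : ∀ {n C₁ C₂} → (∀ a → StepAt C₁ a) → (∀ b → StepAt C₂ b) → ∀ e → StepAt (meas n C₁ C₂) e
  step-meas {n} {C₁} {C₂} sim₁ sim₂ = ∀-dec step
    where
    open Decoding (measDecoding n ⟦ C₁ ⟧ ⟦ C₂ ⟧)
    B₀ = branch₀ n ⟦ C₁ ⟧ ⟦ C₂ ⟧
    B₁ = branch₁ n ⟦ C₁ ⟧ ⟦ C₂ ⟧
    step : ∀ d → StepAt (meas n C₁ C₂) (enc d)
    step τ₀ {f} (unmeasured p) _ _ _ =
      ⟨ C₁ ⟩ , meas₀ ,
      measured₀ (+ₑ-new f (enc τ₀)) (+ₑ-absentᴰ f τ₀ τ₁ (λ ()) (p _)) (λ b → +ₑ-absentᴰ f τ₀ (rgt b) (λ ()) (p _))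
        (Residual-resp (λ a → sym (+ₑ-absentᴰ f τ₀ (lft a) (λ ()) (p _))) (Residual-initial C₁))
    step τ₁ {f} (unmeasured p) _ _ _ =
      ⟨ C₂ ⟩ , meas₁ ,
      measured₁ (+ₑ-new f (enc τ₁)) (+ₑ-absentᴰ f τ₁ τ₀ (λ ()) (p _)) (λ a → +ₑ-absentᴰ f τ₁ (lft a) (λ ()) (p _))
        (Residual-resp (λ b → sym (+ₑ-absentᴰ f τ₁ (rgt b) (λ ()) (p _))) (Residual-initial C₂))
    step (lft a) (unmeasured p) _ _ c' = ⊥-elim (cause-blocks (lft a) τ₀ (p _) (λ ()) tt c')
    step (rgt b) (unmeasured p) _ _ c' = ⊥-elim (cause-blocks (rgt b) τ₁ (p _) (λ ()) tt c')
    step τ₀      (measured₀ p₀ _ _ _) _ fe _  = contradictionᵇ p₀ fe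
    step τ₁      (measured₀ p₀ _ _ _) _ _  c' = ⊥-elim (conflict-blocks τ₁ τ₀ p₀ tt c')
    step (rgt b) (measured₀ p₀ _ _ _) _ _  c' = ⊥-elim (conflict-blocks (rgt b) τ₀ p₀ tt c')
    step (lft a) {f} (measured₀ p₀ p₁ p₂ s) c fa c' =
      let R , t , s' = step-↾ B₀ sim₁ a s c fa c' in
      R , t , measured₀ (+ₑ-old f (enc (lft a)) p₀) (+ₑ-absentᴰ f (lft a) τ₁ (λ ()) p₁)
                        (λ b → +ₑ-absentᴰ f (lft a) (rgt b) (λ ()) (p₂ b)) s'
    step τ₁      (measured₁ p₁ _ _ _) _ fe _  = contradictionᵇ p₁ fe
    step τ₀      (measured₁ p₁ _ _ _) _ _  c' = ⊥-elim (conflict-blocks τ₀ τ₁ p₁ tt c')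
    step (lft a) (measured₁ p₁ _ _ _) _ _  c' = ⊥-elim (conflict-blocks (lft a) τ₁ p₁ tt c')
    step (rgt b) {f} (measured₁ p₁ p₀ p₂ s) c fb c' =
      let R , t , s' = step-↾ B₁ sim₂ b s c fb c' in
      R , t , measured₁ (+ₑ-old f (enc (rgt b)) p₁) (+ₑ-absentᴰ f (rgt b) τ₀ (λ ()) p₀)
                        (λ a → +ₑ-absentᴰ f (rgt b) (lft a) (λ ()) (p₂ a)) s'

  step-seq : ∀ {C₁ C₂} → (∀ a → StepAt C₁ a) → (∀ b → StepAt C₂ b) → ∀ e → StepAt (C₁ ⨾ C₂) e
  step-seq {C₁} {C₂} sim₁ sim₂ = ∀-dec step
    where
    open Decoding (seqDecoding ⟦ C₁ ⟧ ⟦ C₂ ⟧)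
    S₁ = seqFirst ⟦ C₁ ⟧ ⟦ C₂ ⟧
    S  = seqColumn ⟦ C₁ ⟧ ⟦ C₂ ⟧

    step-column : ∀ {f C'} k b → f ↾ S₁ ≗ lookup (maxConfig ⟦ C₁ ⟧ k) →
                  (∀ k' → k' ≢ k → ∀ b' → (f ↾ S k') b' ≡ false) → Residual C₂ (f ↾ S k) ⟨ C' ⟩ →
                  IsCfg ⟦ C₁ ⨾ C₂ ⟧ f → f (enc (snd b k)) ≡ false → IsCfg ⟦ C₁ ⨾ C₂ ⟧ (f +ₑ enc (snd b k)) →
                  ∃ λ R → (C' —[ label ⟦ C₁ ⨾ C₂ ⟧ (enc (snd b k)) ]→ R) × Residual (C₁ ⨾ C₂) (f +ₑ enc (snd b k)) R
    step-column {f} k b p₁ p₂ s c fb c' =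
      let R , t , s' = step-↾ (S k) sim₂ b s c fb c' in
      R , t , second k (λ a → trans (+ₑ-otherᴰ f (snd b k) (fst a) (λ ())) (p₁ a))
                       (λ k' k'≢k b' → +ₑ-absentᴰ f (snd b k) (snd b' k') (λ { refl → k'≢k refl }) (p₂ k' k'≢k b'))
                       s'

    columns-stay-empty : ∀ {f} a → (∀ k b → (f ↾ S k) b ≡ false) →
                         ∀ k b → ((f +ₑ enc (fst a)) ↾ S k) b ≡ false
    columns-stay-empty {f} a p k b = +ₑ-absentᴰ f (fst a) (snd b k) (λ ()) (p k b)

    step : ∀ d → StepAt (C₁ ⨾ C₂) (enc d)
    step (fst a) {f} (first s p) c fa c' with step-↾ S₁ sim₁ a s c fa c'
    ... | ⟨ C₁' ⟩ , t , s' = ⟨ C₁' ⨾ C₂ ⟩ , seq→ t , first s' (columns-stay-empty {f} a p)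
    ... | ✓ , t , s' =
      let k , max≗ = Saturated⇒maxConfig ⟦ C₁ ⟧ (IsCfg-↾ S₁ c') (Residual-✓⇒Saturated C₁ s') in
      ⟨ C₂ ⟩ , seq✓ t ,
      second k (sym ∘ max≗) (λ k' _ → columns-stay-empty {f} a p k')
             (Residual-resp (sym ∘ columns-stay-empty {f} a p k) (Residual-initial C₂))
    -- C₁ has not finished, yet the new event of E₂ requires E₁ to have reached a maximal configuration.
    step (snd b k) {f} (first s _) c _ c' =
      let a , fa , c₁ = Residual-running⇒extendable C₁ s (IsCfg-↾ S₁ c) in
      ⊥-elim (maxConfig-unextendable ⟦ C₁ ⟧ k (λ a' → trans (sym (forced a')) (+ₑ-otherᴰ f (snd b k) (fst a') (λ ())))
                                      fa c₁)
      where
      forced = seqColumn-forces ⟦ C₁ ⟧ ⟦ C₂ ⟧ c' k b (+ₑ-new f (enc (snd b k)))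
    step (fst a) (second k p₁ _ _) _ fa c' =
      ⊥-elim (maxConfig-unextendable ⟦ C₁ ⟧ k (sym ∘ p₁) fa (IsCfg-+ₑ-↾ S₁ c'))
    step (snd b k') {f} {C'} (second k p₁ p₂ s) c fb c' with k' ≟ k
    ... | yes refl = step-column k b p₁ p₂ s c fb c'
    ... | no k'≢k with any? (λ b₀ → T? ((f ↾ S k) b₀))
    ...   | yes (b₀ , fb₀) =
      ⊥-elim (conflict-blocks (snd b k') (snd b₀ k) (Equivalence.to T-≡ fb₀)
               (subst (λ z → T (not z ∨ _)) (sym (⌊⌋-no (k' ≟ k) k'≢k)) tt) c')
    -- Nothing of C₂ has happened yet, so its run can equally be placed in column k'.
    ...   | no column-k-empty =
      step-column k' b (λ a → trans (sym (+ₑ-otherᴰ f (snd b k') (fst a) (λ ()))) (forced a)) p₂' s' c fb c'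
      where
      forced = seqColumn-forces ⟦ C₁ ⟧ ⟦ C₂ ⟧ c' k' b (+ₑ-new f (enc (snd b k')))
      empty : ∀ b₀ → (f ↾ S k) b₀ ≡ false
      empty b₀ = ¬-not λ fb₀ → column-k-empty (b₀ , Equivalence.from T-≡ fb₀)
      p₂' : ∀ k'' → k'' ≢ k' → ∀ b' → (f ↾ S k'') b' ≡ false
      p₂' k'' k''≢k' b' with k'' ≟ k
      ... | yes refl  = empty b'
      ... | no k''≢k = p₂ k'' k''≢k b'
      s' : Residual C₂ (f ↾ S k') ⟨ C' ⟩
      s' = Residual-resp (λ b' → trans (empty b') (sym (p₂ k' k'≢k b'))) s

  Residual-step : ∀ C e → StepAt C e
  Residual-step skip       zero {f} (skip-pending _) _ _ _ = ✓ , skip→ , skip-done (+ₑ-new f zero)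
  Residual-step (gate _ _) zero {f} (gate-pending _) _ _ _ = ✓ , gate→ , gate-done (+ₑ-new f zero)
  Residual-step (C₁ ∥ C₂)      = step-par  (Residual-step C₁) (Residual-step C₂)
  Residual-step (meas _ C₁ C₂) = step-meas (Residual-step C₁) (Residual-step C₂)
  Residual-step (C₁ ⨾ C₂)      = step-seq  (Residual-step C₁) (Residual-step C₂)

-- Runs along covering chains

module _ {G : Set} {N : ℕ} where

  infix  3 _=[_]↠*_
  infixl 4 _▷_

  data _=[_]↠*_ : Cmd G N → List (Label G N) → Res G N → Set where
    ε   : ∀ {C} → C =[ [] ]↠* ⟨ C ⟩
    _▷_ : ∀ {C C' ω l R} → C =[ ω ]↠* ⟨ C' ⟩ → C' —[ l ]→ R → C =[ ω ∷ʳ l ]↠* R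

  ↠-snoc : ∀ {C C' : Cmd G N} {ω l R} → C =[ ω ]↠ ⟨ C' ⟩ → C' —[ l ]→ R → C =[ ω ∷ʳ l ]↠ R
  ↠-snoc (one t)    t' = more t (one t')
  ↠-snoc (more t r) t' = more t (↠-snoc r t')

  ▷-↠ : ∀ {C C' : Cmd G N} {ω l R} → C =[ ω ]↠* ⟨ C' ⟩ → C' —[ l ]→ R → C =[ ω ∷ʳ l ]↠ R
  ▷-↠ ε        t = one t
  ▷-↠ (r ▷ t') t = ↠-snoc (▷-↠ r t') t

  CoveringChain⇒IsCfg : ∀ {E : EvStr G N} {x es} → CoveringChain E x es → IsCfg E (lookup x)
  CoveringChain⇒IsCfg start          = IsCfg-resp (λ i → sym (lookup-replicate i false)) IsCfg-∅
  CoveringChain⇒IsCfg (extend _ _ c) = IsConfig⇒IsCfg c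

  chain-step : ∀ (C : Cmd G N) {x R e} → IsCfg ⟦ C ⟧ (lookup x) → Residual C (lookup x) R → e ∉ x →
               IsConfig ⟦ C ⟧ (x ∪ ⁅ e ⁆) →
               ∃₂ λ C' R' → R ≡ ⟨ C' ⟩ × (C' —[ label ⟦ C ⟧ e ]→ R') × Residual C (lookup (x ∪ ⁅ e ⁆)) R'
  chain-step C {x} {✓} {e} _ s e∉x c' =
    ⊥-elim (Saturated⇒unextendable (Residual-✓⇒Saturated C s) (lookup-∉ e∉x)
             (IsCfg-resp (lookup-∪⁅⁆ x e) (IsConfig⇒IsCfg c')))
  chain-step C {x} {⟨ C' ⟩} {e} c s e∉x c' =
    let R' , t , s' = Residual-step C e s c (lookup-∉ e∉x) (IsCfg-resp (lookup-∪⁅⁆ x e) (IsConfig⇒IsCfg c')) in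
    C' , R' , refl , t , Residual-resp (sym ∘ lookup-∪⁅⁆ x e) s'

  chain-run : ∀ (C : Cmd G N) {x es} → CoveringChain ⟦ C ⟧ x es →
              ∃ λ R → (C =[ map (label ⟦ C ⟧) es ]↠* R) × Residual C (lookup x) R
  chain-run C start = ⟨ C ⟩ , ε , Residual-resp (λ i → sym (lookup-replicate i false)) (Residual-initial C)
  chain-run C (extend {es = es} {e} ch e∉x c') with chain-run C ch
  ... | R , r , s with chain-step C (CoveringChain⇒IsCfg ch) s e∉x c'
  ...   | C' , R' , refl , t , s' =
    R' , subst (λ ω → C =[ ω ]↠* R') (sym (map-++ (label ⟦ C ⟧) es (e ∷ []))) (r ▷ t) , s'

mainTheorem6 : {G : Set} {N : ℕ} (C : Cmd G N) → WF C →
    (x : Subset (EvStr.size ⟦ C ⟧)) → IsConfig ⟦ C ⟧ x → Nonempty x →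
    (es : List (Fin (EvStr.size ⟦ C ⟧))) → CoveringChain ⟦ C ⟧ x es →
    ∃ λ (C' : Res G N) → C =[ map (EvStr.label ⟦ C ⟧) es ]↠ C'
mainTheorem6 C _ _ _ x≢∅ _ start = ⊥-elim (∉⊥ (proj₂ x≢∅))
mainTheorem6 C _ _ _ _ _ (extend {es = es} {e} ch e∉x c') with chain-run C ch
... | R , r , s with chain-step C (CoveringChain⇒IsCfg ch) s e∉x c'
...   | C' , R' , refl , t , _ =
  R' , subst (λ ω → C =[ ω ]↠ R') (sym (map-++ (label ⟦ C ⟧) es (e ∷ []))) (▷-↠ r t)
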